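{- Let $G=(V,E,\sigma)$ be a balanced signed graph with vertices $v_1,\dots,v_n$, and let $H_1,\dots,H_n$ be balanced signed graphs, where $H_l$ has signature $\sigma_l$ and canonical marking $\mu_l$. Suppose that for at least one index $j\in\{1,\dots,n\}$ the graph $H_j$ contains an edge $uw$ of one of the following types: (1) $\sigma_j(uw)=+1$ and $\mu_j(u)\neq\mu_j(w)$ (a positive edge joining two oppositely marked vertices); (2) $\sigma_j(uw)=-1$ and $\mu_j(u)=\mu_j(w)=-1$ (a negative edge joining two negatively marked vertices); (3) $\sigma_j(uw)=-1$ and $\mu_j(u)=\mu_j(w)=+1$ (a negative edge joining two positively marked vertices). Then the generalized corona product $G\circ\Lambda_{l=1}^{n}H_l$ is unbalanced.
   Context: A signed graph $G=(V,E,\sigma)$ is a finite simple graph with a signature $\sigma:E\to\{+1,-1\}$. Its canonical marking is $\mu:V\to\{+1,-1\}$, $\mu(v)=\prod_{e\ni v}\sigma(e)$, the product of the signs of all edges incident to $v$ (an empty product is $+1$); every signed graph is equipped with this marking. A signed graph is balanced if every cycle contains an even number of negative edges, and unbalanced otherwise. Generalized corona product: if $G$ has vertices $v_1,\dots,v_n$ and canonical marking $\mu$, and $H_1,\dots,H_n$ are signed graphs with canonical markings $\mu_1,\dots,\mu_n$, then $G\circ\Lambda_{l=1}^{n}H_l$ is the signed graph obtained from the disjoint union of $G,H_1,\dots,H_n$ (keeping all their edges and signs) by adding, for each $l$, an edge from $v_l$ to every vertex $w$ of $H_l$, with sign $\mu(v_l)\mu_l(w)$. -}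

module Defs where

open import Data.Nat using (ℕ; zero; suc; _+_)
open import Data.Nat.Divisibility using (_∣_)
open import Data.Nat.DivMod using (_%_; m%n<n)
open import Data.Fin using (Fin; zero; suc; toℕ; fromℕ<; splitAt; _≟_)
open import Data.Sign using (Sign) renaming (_*_ to _*ˢ_; + to s+; - to s-)
open import Data.Maybe using (Maybe; just; nothing)
open import Data.Product using (Σ; _,_; proj₁; proj₂; _×_)
open import Data.Sum using (_⊎_; inj₁; inj₂)
open import Data.Bool using (if_then_else_)
open import Relation.Nullary using (yes; no; ¬_)
open import Relation.Nullary.Decidable using (⌊_⌋)
open import Relation.Binary.PropositionalEquality using (_≡_; refl; sym; _≢_)
open import Function.Definitions using (Injective)

-- Signed graphs on the vertex set Fin size.
-- adj u w = nothing : no edge;  adj u w = just s : an edge of sign s.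

record RawSignedGraph : Set where
  field
    size : ℕ
    adj  : Fin size → Fin size → Maybe Sign
open RawSignedGraph public

record SignedGraph : Set where
  field
    raw        : RawSignedGraph
    adj-sym    : ∀ u w → adj raw u w ≡ adj raw w u
    adj-irrefl : ∀ u → adj raw u u ≡ nothing
open SignedGraph public

prodSign : ∀ {m} → (Fin m → Sign) → Sign
prodSign {zero}  f = s+
prodSign {suc m} f = f zero *ˢ prodSign (λ i → f (suc i))

sumFin : ∀ {m} → (Fin m → ℕ) → ℕ
sumFin {zero}  f = 0
sumFin {suc m} f = f zero + sumFin (λ i → f (suc i))

edgeSign : Maybe Sign → Sign
edgeSign nothing  = s+
edgeSign (just s) = s

marking : (G : RawSignedGraph) → Fin (size G) → Sign
marking G v = prodSign (λ w → edgeSign (adj G v w))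

next : ∀ {m} → Fin (suc m) → Fin (suc m)
next {m} i = fromℕ< (m%n<n (suc (toℕ i)) (suc m))

isNeg : Maybe Sign → ℕ
isNeg (just s-) = 1
isNeg _        = 0

IsCycle : (G : RawSignedGraph) (k : ℕ) → (Fin (3 + k) → Fin (size G)) → Set
IsCycle G k c =
  Injective _≡_ _≡_ c × (∀ i → adj G (c i) (c (next i)) ≢ nothing)

negEdges : (G : RawSignedGraph) (k : ℕ) → (Fin (3 + k) → Fin (size G)) → ℕ
negEdges G k c = sumFin (λ i → isNeg (adj G (c i) (c (next i))))

Balanced : RawSignedGraph → Set
Balanced G = ∀ k (c : Fin (3 + k) → Fin (size G)) → IsCycle G k c → 2 ∣ negEdges G k c

Unbalanced : RawSignedGraph → Set
Unbalanced G = ¬ Balanced G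

splitΣ : ∀ {n} (s : Fin n → ℕ) → Fin (sumFin s) → Σ (Fin n) (λ l → Fin (s l))
splitΣ {zero}  s ()
splitΣ {suc n} s i with splitAt (s zero) i
... | inj₁ w = zero , w
... | inj₂ j with splitΣ (λ l → s (suc l)) j
...   | l , w = suc l , w

module Corona (G : RawSignedGraph) (H : Fin (size G) → RawSignedGraph) where
  n : ℕ
  n = size G

  hs : Fin n → ℕ
  hs l = size (H l)

  CV : Set
  CV = Fin n ⊎ Σ (Fin n) (λ l → Fin (hs l))

  decode : Fin (n + sumFin hs) → CV
  decode i with splitAt n i
  ... | inj₁ v = inj₁ v
  ... | inj₂ j = inj₂ (splitΣ hs j)

  cross : Fin n → Σ (Fin n) (λ l → Fin (hs l)) → Maybe Sign
  cross a (l , w) = if ⌊ a ≟ l ⌋ then just (marking G a *ˢ marking (H l) w) else nothing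

  adjCV : CV → CV → Maybe Sign
  adjCV (inj₁ a) (inj₁ b) = adj G a b
  adjCV (inj₁ a) (inj₂ p) = cross a p
  adjCV (inj₂ p) (inj₁ a) = cross a p
  adjCV (inj₂ (l , w)) (inj₂ (l' , w')) with l ≟ l'
  ... | yes refl = adj (H l) w w'
  ... | no _     = nothing

  product : RawSignedGraph
  product = record { size = n + sumFin hs ; adj = λ x y → adjCV (decode x) (decode y) }

coronaProduct : (G : RawSignedGraph) → (Fin (size G) → RawSignedGraph) → RawSignedGraph
coronaProduct = Corona.product

{-# OPTIONS --safe #-}
-- If u w is an edge of H_j with σ_j(uw) μ_j(u) μ_j(w) = −, which is exactly what each of the
-- three edge types says, then v_j, u, w span a triangle of the corona. Its two spokes carry
-- the signs μ(v_j) μ_j(u) and μ(v_j) μ_j(w), so the sign of the triangle is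
-- μ(v_j)² σ_j(uw) μ_j(u) μ_j(w) = −, i.e. it has an odd number of negative edges.
module Submission where

open import Defs
open import Data.Fin using (Fin)
open import Data.Sign using (Sign) renaming (+ to s+; - to s-)
open import Data.Maybe using (just)
open import Data.Product using (Σ; _×_)
open import Data.Sum using (_⊎_)
open import Relation.Binary.PropositionalEquality using (_≡_; _≢_)

open import Data.Nat using (ℕ; zero; suc; _+_)
open import Data.Nat.Divisibility using (_∣_; divides)
open import Data.Fin using (zero; suc; _↑ˡ_; _↑ʳ_; _≟_)
open import Data.Fin.Properties using (splitAt-↑ˡ; splitAt-↑ʳ)
open import Data.Sign using () renaming (_*_ to _*ˢ_)
open import Data.Sign.Properties using (*-comm; *-assoc; s*s≡+; *-commutativeSemigroup)
open import Algebra.Properties.CommutativeSemigroup *-commutativeSemigroup using (interchange)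
open import Data.Maybe using (Maybe; nothing)
open import Data.Product using (_,_)
open import Data.Sum using (inj₁; inj₂)
open import Relation.Nullary using (¬_; yes; no; contradiction)
open import Relation.Binary.PropositionalEquality
  using (refl; sym; trans; cong; cong₂; subst; module ≡-Reasoning)

distinct⇒product≡- : ∀ {b c} → b ≢ c → b *ˢ c ≡ s-
distinct⇒product≡- { s+ } { s+ } b≢c = contradiction refl b≢c
distinct⇒product≡- { s+ } { s- } _   = refl
distinct⇒product≡- { s- } { s+ } _   = refl
distinct⇒product≡- { s- } { s- } b≢c = contradiction refl b≢c

conjugate-cancels : ∀ a b s c → (a *ˢ b) *ˢ s *ˢ (a *ˢ c) ≡ s *ˢ b *ˢ c
conjugate-cancels a b s c = begin
  (a *ˢ b) *ˢ s *ˢ (a *ˢ c)   ≡⟨ cong (_*ˢ (a *ˢ c)) (*-comm (a *ˢ b) s) ⟩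
  s *ˢ (a *ˢ b) *ˢ (a *ˢ c)   ≡⟨ *-assoc s (a *ˢ b) (a *ˢ c) ⟩
  s *ˢ ((a *ˢ b) *ˢ (a *ˢ c)) ≡⟨ cong (s *ˢ_) (interchange a b a c) ⟩
  s *ˢ ((a *ˢ a) *ˢ (b *ˢ c)) ≡⟨ cong (λ t → s *ˢ (t *ˢ (b *ˢ c))) (s*s≡+ a) ⟩
  s *ˢ (b *ˢ c)               ≡⟨ *-assoc s b c ⟨
  s *ˢ b *ˢ c                 ∎
  where open ≡-Reasoning

negative-triangle-odd : ∀ a b c → a *ˢ b *ˢ c ≡ s- →
  ¬ 2 ∣ isNeg (just a) + (isNeg (just b) + (isNeg (just c) + 0))
negative-triangle-odd s+ s+ s- _ (divides (suc _) ())
negative-triangle-odd s+ s- s+ _ (divides (suc _) ())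
negative-triangle-odd s- s+ s+ _ (divides (suc _) ())
negative-triangle-odd s- s- s- _ (divides (suc (suc _)) ())

present⇒≢nothing : ∀ {m : Maybe Sign} {s} → m ≡ just s → m ≢ nothing
present⇒≢nothing refl ()

negative-triangle⇒unbalanced : (G : RawSignedGraph) {x y z : Fin (size G)} {a b c : Sign} →
  x ≢ y → y ≢ z → z ≢ x →
  adj G x y ≡ just a → adj G y z ≡ just b → adj G z x ≡ just c →
  a *ˢ b *ˢ c ≡ s- → Unbalanced G
negative-triangle⇒unbalanced G {x} {y} {z} {a} {b} {c} x≢y y≢z z≢x xy yz zx negative balanced =
  negative-triangle-odd a b c negative (subst (2 ∣_) count (balanced 0 t (t-injective , t-adjacent)))
  where
  t : Fin 3 → Fin (size G)
  t zero             = x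
  t (suc zero)       = y
  t (suc (suc zero)) = z

  t-injective : ∀ {i k} → t i ≡ t k → i ≡ k
  t-injective {zero}             {zero}             _ = refl
  t-injective {zero}             {suc zero}         e = contradiction e x≢y
  t-injective {zero}             {suc (suc zero)}   e = contradiction (sym e) z≢x
  t-injective {suc zero}         {zero}             e = contradiction (sym e) x≢y
  t-injective {suc zero}         {suc zero}         _ = refl
  t-injective {suc zero}         {suc (suc zero)}   e = contradiction e y≢z
  t-injective {suc (suc zero)}   {zero}             e = contradiction e z≢x
  t-injective {suc (suc zero)}   {suc zero}         e = contradiction (sym e) y≢z
  t-injective {suc (suc zero)}   {suc (suc zero)}   _ = refl

  t-adjacent : ∀ i → adj G (t i) (t (next i)) ≢ nothing
  t-adjacent zero             = present⇒≢nothing xy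
  t-adjacent (suc zero)       = present⇒≢nothing yz
  t-adjacent (suc (suc zero)) = present⇒≢nothing zx

  count : negEdges G 0 t ≡ isNeg (just a) + (isNeg (just b) + (isNeg (just c) + 0))
  count = cong₂ _+_ (cong isNeg xy) (cong₂ _+_ (cong isNeg yz) (cong (λ e → isNeg e + 0) zx))

EdgeType : Maybe Sign → Sign → Sign → Set
EdgeType e b c = (e ≡ just s+ × b ≢ c) ⊎ (e ≡ just s- × b ≡ s- × c ≡ s-) ⊎ (e ≡ just s- × b ≡ s+ × c ≡ s+)

edgeType⇒negative : ∀ {e b c} → EdgeType e b c → Σ Sign λ s → e ≡ just s × s *ˢ b *ˢ c ≡ s-
edgeType⇒negative (inj₁ (refl , b≢c))               = s+ , refl , distinct⇒product≡- b≢c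
edgeType⇒negative (inj₂ (inj₁ (refl , refl , refl))) = s- , refl , refl
edgeType⇒negative (inj₂ (inj₂ (refl , refl , refl))) = s- , refl , refl

encodeΣ : ∀ {n} (s : Fin n → ℕ) → Σ (Fin n) (λ l → Fin (s l)) → Fin (sumFin s)
encodeΣ {suc n} s (zero  , w) = w ↑ˡ sumFin (λ l → s (suc l))
encodeΣ {suc n} s (suc l , w) = s zero ↑ʳ encodeΣ (λ l → s (suc l)) (l , w)

splitΣ-encodeΣ : ∀ {n} (s : Fin n → ℕ) p → splitΣ s (encodeΣ s p) ≡ p
splitΣ-encodeΣ {suc n} s (zero , w) rewrite splitAt-↑ˡ (s zero) w (sumFin (λ l → s (suc l))) = refl
splitΣ-encodeΣ {suc n} s (suc l , w)
  rewrite splitAt-↑ʳ (s zero) (sumFin (λ l → s (suc l))) (encodeΣ (λ l → s (suc l)) (l , w))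
        | splitΣ-encodeΣ (λ l → s (suc l)) (l , w) = refl

module CoronaTriangle (G : RawSignedGraph) (H : Fin (size G) → RawSignedGraph) where
  open Corona G H

  encode : CV → Fin (size product)
  encode (inj₁ v) = v ↑ˡ sumFin hs
  encode (inj₂ p) = n ↑ʳ encodeΣ hs p

  decode-encode : ∀ x → decode (encode x) ≡ x
  decode-encode (inj₁ v) rewrite splitAt-↑ˡ n v (sumFin hs) = refl
  decode-encode (inj₂ p) rewrite splitAt-↑ʳ n (sumFin hs) (encodeΣ hs p) | splitΣ-encodeΣ hs p = refl

  encode-injective : ∀ {x y} → encode x ≡ encode y → x ≡ y
  encode-injective {x} {y} e = trans (sym (decode-encode x)) (trans (cong decode e) (decode-encode y))

  adj-encode : ∀ x y → adj product (encode x) (encode y) ≡ adjCV x y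
  adj-encode x y = cong₂ adjCV (decode-encode x) (decode-encode y)

  spoke : ∀ j u → cross j (j , u) ≡ just (marking G j *ˢ marking (H j) u)
  spoke j u with j ≟ j
  ... | yes _  = refl
  ... | no j≢j = contradiction refl j≢j

  leaf-edge : ∀ j u w → adjCV (inj₂ (j , u)) (inj₂ (j , w)) ≡ adj (H j) u w
  leaf-edge j u w with j ≟ j
  ... | yes refl = refl
  ... | no j≢j   = contradiction refl j≢j

  negative-edge⇒unbalanced : ∀ j {u w s} → adj (H j) u u ≡ nothing →
    adj (H j) u w ≡ just s → s *ˢ marking (H j) u *ˢ marking (H j) w ≡ s- → Unbalanced product
  negative-edge⇒unbalanced j {u} {w} {s} uu uw negative =
    negative-triangle⇒unbalanced product hub≢u u≢w w≢hub
      (trans (adj-encode hub (leaf u)) (spoke j u))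
      (trans (adj-encode (leaf u) (leaf w)) (trans (leaf-edge j u w) uw))
      (trans (adj-encode (leaf w) hub) (spoke j w))
      (trans (conjugate-cancels (marking G j) (marking (H j) u) s (marking (H j) w)) negative)
    where
    hub : CV
    hub = inj₁ j

    leaf : Fin (hs j) → CV
    leaf v = inj₂ (j , v)

    hub≢u : encode hub ≢ encode (leaf u)
    hub≢u e with encode-injective {hub} {leaf u} e
    ... | ()

    w≢hub : encode (leaf w) ≢ encode hub
    w≢hub e with encode-injective {leaf w} {hub} e
    ... | ()

    u≢w : encode (leaf u) ≢ encode (leaf w)
    u≢w e with encode-injective {leaf u} {leaf w} e
    ... | refl = present⇒≢nothing uw uu

mainTheorem1 : (G : SignedGraph) (H : Fin (size (raw G)) → SignedGraph)
    → Balanced (raw G)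
    → (∀ l → Balanced (raw (H l)))
    → Σ (Fin (size (raw G))) (λ j → Σ (Fin (size (raw (H j)))) (λ u → Σ (Fin (size (raw (H j)))) (λ w →
        (adj (raw (H j)) u w ≡ just s+ × marking (raw (H j)) u ≢ marking (raw (H j)) w)
        ⊎ (adj (raw (H j)) u w ≡ just s- × marking (raw (H j)) u ≡ s- × marking (raw (H j)) w ≡ s-)
        ⊎ (adj (raw (H j)) u w ≡ just s- × marking (raw (H j)) u ≡ s+ × marking (raw (H j)) w ≡ s+))))
    → Unbalanced (coronaProduct (raw G) (λ l → raw (H l)))
mainTheorem1 G H _ _ (j , u , w , edgeType) with edgeType⇒negative edgeType
... | s , uw , negative =
  CoronaTriangle.negative-edge⇒unbalanced (raw G) (λ l → raw (H l)) j (adj-irrefl (H j) u) uw negative
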